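{- Let $l\ge1$ and let $Y_l$ be the set of cyclic equivalence classes of $\{y,z\}^l$. Then the family $\{\tilde{\rho}_0(U)\mid U\in Y_l\setminus\{[(z,\dots,z)]\}\}$ (indexed by $U$) is $\mathbb{Q}$-linearly independent in $\mathfrak{H}$.
   Context: Let $\mathfrak{H}=\mathbb{Q}\langle x,y\rangle$ be the noncommutative polynomial algebra over $\mathbb{Q}$ in $x,y$, and $z=x+y$. Make $\mathfrak{H}\otimes\mathfrak{H}$ an $\mathfrak{H}$-bimodule via $a\diamond(w_1\otimes w_2)\diamond b=w_1b\otimes aw_2$. Let $\mathcal{C}_0\colon\mathfrak{H}\to\mathfrak{H}\otimes\mathfrak{H}$ be the $\mathbb{Q}$-linear map with $\mathcal{C}_0(1)=0$, $\mathcal{C}_0(x)=x\otimes y$, $\mathcal{C}_0(y)=-x\otimes y$, $\mathcal{C}_0(ww')=\mathcal{C}_0(w)\diamond w'+w\diamond\mathcal{C}_0(w')$, and $\rho_0=M_0\circ\mathcal{C}_0$ with $M_0(w_1\otimes w_2)=w_1w_2$. The cyclic group $\mathbb{Z}/l\mathbb{Z}$ acts on $X_l=\{y,z\}^l$ by $j(u_1,\dots,u_l)=(u_{j+1},\dots,u_{j+l})$ (indices modulo $l$); $Y_l=X_l/\mathbb{Z}/l\mathbb{Z}$. For $U=[(u_1,\dots,u_l)]\in Y_l$ put $\tilde{\rho}_0(U)=\rho_0(u_1\cdots u_l)$, which is independent of the representative. -}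

module Defs where

open import Data.Nat using (ℕ; zero; suc)
open import Data.Rational using (ℚ; 0ℚ; 1ℚ; _+_; _*_; -_)
open import Data.List as L using (List; []; _∷_; _++_; concatMap; map)
open import Data.List.Properties using (≡-dec)
open import Data.Vec as V using (Vec; []; _∷_; _∷ʳ_)
open import Data.Product using (_×_; _,_; ∃-syntax)
open import Relation.Binary.PropositionalEquality using (_≡_; refl)
open import Relation.Binary.Definitions using (DecidableEquality)
open import Relation.Nullary using (yes; no)

data XY : Set where
  X Y : XY

_≟XY_ : DecidableEquality XY
X ≟XY X = yes refl
X ≟XY Y = no λ ()
Y ≟XY X = no λ ()
Y ≟XY Y = yes refl

Word : Set
Word = List XY

-- An element of 𝔥: a formal finite ℚ-linear combination of words.
-- Two formal sums denote the same element iff all coefficients agree.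
H : Set
H = List (ℚ × Word)

coeff : H → Word → ℚ
coeff [] w = 0ℚ
coeff ((c , v) ∷ p) w with ≡-dec _≟XY_ v w
... | yes _ = c + coeff p w
... | no  _ = coeff p w

IsZero : H → Set
IsZero p = ∀ w → coeff p w ≡ 0ℚ

scale : ℚ → H → H
scale c = map (λ { (d , w) → (c * d , w) })

_·_ : H → H → H
p · q = concatMap (λ { (c , v) → map (λ { (d , w) → (c * d , v ++ w) }) q }) p

one : H
one = (1ℚ , []) ∷ []

H⊗H : Set
H⊗H = List (ℚ × (Word × Word))

_⋄ₗ_ : Word → H⊗H → H⊗H
a ⋄ₗ t = map (λ { (c , (w₁ , w₂)) → (c , (w₁ , a ++ w₂)) }) t

_⋄ᵣ_ : H⊗H → Word → H⊗H
t ⋄ᵣ b = map (λ { (c , (w₁ , w₂)) → (c , (w₁ ++ b , w₂)) }) t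

C₀gen : XY → H⊗H
C₀gen X = (1ℚ , (X ∷ [] , Y ∷ [])) ∷ []
C₀gen Y = (- 1ℚ , (X ∷ [] , Y ∷ [])) ∷ []

-- C₀ on words, via the Leibniz rule C₀(u w) = C₀(u) ⋄ w + u ⋄ C₀(w), C₀(1) = 0
C₀word : Word → H⊗H
C₀word [] = []
C₀word (u ∷ w) = (C₀gen u ⋄ᵣ w) ++ ((u ∷ []) ⋄ₗ C₀word w)

C₀ : H → H⊗H
C₀ p = concatMap (λ { (c , w) → map (λ { (d , t) → (c * d , t) }) (C₀word w) }) p

M₀ : H⊗H → H
M₀ = map (λ { (c , (w₁ , w₂)) → (c , w₁ ++ w₂) })

ρ₀ : H → H
ρ₀ p = M₀ (C₀ p)

data YZ : Set where
  y z : YZ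

⟦_⟧ : YZ → H
⟦ y ⟧ = (1ℚ , Y ∷ []) ∷ []
⟦ z ⟧ = (1ℚ , X ∷ []) ∷ (1ℚ , Y ∷ []) ∷ []

prodYZ : ∀ {l} → Vec YZ l → H
prodYZ u = L.foldr (λ a p → ⟦ a ⟧ · p) one (V.toList u)

rot₁ : ∀ {l} → Vec YZ l → Vec YZ l
rot₁ [] = []
rot₁ (u ∷ us) = us ∷ʳ u

rot : ∀ {l} → ℕ → Vec YZ l → Vec YZ l
rot zero u = u
rot (suc j) u = rot₁ (rot j u)

-- same cyclic class, i.e. same element of Y_l
CycEq : ∀ {l} → Vec YZ l → Vec YZ l → Set
CycEq u v = ∃[ j ] rot j u ≡ v

ρ̃₀ : ∀ {l} → Vec YZ l → H
ρ̃₀ u = ρ₀ (prodYZ u)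

linComb : ∀ {l} → List (ℚ × Vec YZ l) → H
linComb fam = concatMap (λ { (c , u) → scale c (ρ̃₀ u) }) fam

-- Expanding the Leibniz rule, ρ₀(a₁⋯aₙ) = Σᵢ sgn(aᵢ) x aᵢ₊₁⋯aₙ a₁⋯aᵢ₋₁ y with sgn x = 1,
-- sgn y = −1. In a product of letters y and z = x + y the two halves of a z cancel, so
-- ρ̃₀(U) = −Σ x (uᵢ₊₁⋯uᵢ₋₁) y, summed over the positions i of U carrying a y.
-- Products of y and z form a basis of 𝔥; hence the coefficient of x m y in ρ̃₀(U) is minus the
-- number of ways of cutting U at a y so that the word m is left, which is negative if U is the
-- class of y m and zero otherwise. Cutting one member U₀ of the family at a y thus yields a
-- linear functional that vanishes on every other member and not on U₀, so the coefficient of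
-- U₀ is zero.

module Submission where

open import Defs
open import Data.Nat using (ℕ; _≤_)
open import Data.Rational using (ℚ; 0ℚ)
open import Data.List using (List)
open import Data.List.Relation.Unary.All using (All)
open import Data.List.Relation.Unary.AllPairs using (AllPairs)
open import Data.Vec using (Vec; replicate)
open import Data.Product using (_×_; proj₁; proj₂)
open import Relation.Binary.PropositionalEquality using (_≡_)
open import Relation.Nullary using (¬_)

open import Algebra.Bundles using (CommutativeMonoid)
open import Data.Empty using (⊥-elim)
open import Data.List as L using ([]; _∷_; _++_; map; concatMap; length)
import Data.List.Properties as L
open import Data.List.Membership.Propositional using (_∈_)
open import Data.List.Relation.Unary.All as All using ([]; _∷_)
open import Data.List.Relation.Unary.AllPairs using ([]; _∷_)
open import Data.List.Relation.Unary.Any using (here; there)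
import Data.Nat as ℕ
import Data.Nat.Properties as ℕ
open import Data.Product using (_,_; ∃-syntax)
open import Data.Rational using (1ℚ; _+_; _*_; -_; _<_) renaming (_≤_ to _≤ℚ_)
import Data.Rational as ℚ
import Data.Rational.Properties as ℚ
open import Data.Rational.Solver using (module +-*-Solver)
open +-*-Solver using (solve; _:+_; _:*_; :-_; _:=_; con)
open import Algebra.Properties.CommutativeSemigroup (CommutativeMonoid.commutativeSemigroup ℚ.+-0-commutativeMonoid)
  using () renaming (interchange to +-interchange)
open import Data.Sum using (_⊎_; inj₁; inj₂)
import Data.Vec as V
import Data.Vec.Properties as V
open import Function using (_∘_)
open import Relation.Binary.PropositionalEquality using (refl; sym; trans; cong; cong₂; subst; _≢_; module ≡-Reasoning)
open import Relation.Nullary using (yes; no)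

lin : {A : Set} → (A → ℚ) → List (ℚ × A) → ℚ
lin f [] = 0ℚ
lin f ((c , a) ∷ p) = c * f a + lin f p

lin-++ : {A : Set} (f : A → ℚ) (p q : List (ℚ × A)) → lin f (p ++ q) ≡ lin f p + lin f q
lin-++ f [] q = sym (ℚ.+-identityˡ (lin f q))
lin-++ f ((c , a) ∷ p) q =
  trans (cong (c * f a +_) (lin-++ f p q)) (sym (ℚ.+-assoc (c * f a) (lin f p) (lin f q)))

lin-scale : (g : Word → ℚ) (c : ℚ) (p : H) → lin g (scale c p) ≡ c * lin g p
lin-scale g c [] = sym (ℚ.*-zeroʳ c)
lin-scale g c ((d , w) ∷ p) = begin
  c * d * g w + lin g (scale c p)  ≡⟨ cong₂ _+_ (ℚ.*-assoc c d (g w)) (lin-scale g c p) ⟩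
  c * (d * g w) + c * lin g p      ≡⟨ ℚ.*-distribˡ-+ c (d * g w) (lin g p) ⟨
  c * (d * g w + lin g p)          ∎
  where open ≡-Reasoning

lin-concatMap-scale : {A : Set} (g : Word → ℚ) (F : A → H) (p : List (ℚ × A))
  → lin g (concatMap (λ { (c , a) → scale c (F a) }) p) ≡ lin (λ a → lin g (F a)) p
lin-concatMap-scale g F [] = refl
lin-concatMap-scale g F ((c , a) ∷ p) =
  trans (lin-++ g (scale c (F a)) _) (cong₂ _+_ (lin-scale g c (F a)) (lin-concatMap-scale g F p))

lin-· : (g : Word → ℚ) (p q : H) → lin g (p · q) ≡ lin (λ v → lin (λ w → g (v ++ w)) q) p
lin-· g [] q = refl
lin-· g ((c , v) ∷ p) q =
  trans (lin-++ g (map (λ { (d , w) → (c * d , v ++ w) }) q) (p · q)) (cong₂ _+_ (lin-prefix q) (lin-· g p q))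
  where
  lin-prefix : ∀ q → lin g (map (λ { (d , w) → (c * d , v ++ w) }) q) ≡ c * lin (λ w → g (v ++ w)) q
  lin-prefix [] = sym (ℚ.*-zeroʳ c)
  lin-prefix ((d , w) ∷ q) =
    trans (cong₂ _+_ (ℚ.*-assoc c d (g (v ++ w))) (lin-prefix q))
          (sym (ℚ.*-distribˡ-+ c (d * g (v ++ w)) (lin (λ w → g (v ++ w)) q)))

without : Word → H → H
without v [] = []
without v ((c , w) ∷ p) with L.≡-dec _≟XY_ w v
... | yes _ = without v p
... | no _  = (c , w) ∷ without v p

coeff-∷-≢ : ∀ {w v} c p → w ≢ v → coeff ((c , w) ∷ p) v ≡ coeff p v
coeff-∷-≢ {w} {v} c p w≢v with L.≡-dec _≟XY_ w v
... | yes w≡v = ⊥-elim (w≢v w≡v)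
... | no _    = refl

coeff-without-≡ : ∀ v p → coeff (without v p) v ≡ 0ℚ
coeff-without-≡ v [] = refl
coeff-without-≡ v ((c , w) ∷ p) with L.≡-dec _≟XY_ w v
... | yes _  = coeff-without-≡ v p
... | no w≢v = trans (coeff-∷-≢ c (without v p) w≢v) (coeff-without-≡ v p)

coeff-without-≢ : ∀ {v u} p → u ≢ v → coeff (without v p) u ≡ coeff p u
coeff-without-≢ [] u≢v = refl
coeff-without-≢ {v} {u} ((c , w) ∷ p) u≢v with L.≡-dec _≟XY_ w v
... | yes refl = trans (coeff-without-≢ p u≢v) (sym (coeff-∷-≢ c p (u≢v ∘ sym)))
... | no _ with L.≡-dec _≟XY_ w u
...   | yes _ = cong (c +_) (coeff-without-≢ p u≢v)
...   | no _  = coeff-without-≢ p u≢v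

IsZero-without : ∀ v p → IsZero p → IsZero (without v p)
IsZero-without v p p≈0 u with L.≡-dec _≟XY_ u v
... | yes refl = coeff-without-≡ v p
... | no u≢v   = trans (coeff-without-≢ p u≢v) (p≈0 u)

length-without : ∀ v p → length (without v p) ℕ.≤ length p
length-without v [] = ℕ.z≤n
length-without v ((c , w) ∷ p) with L.≡-dec _≟XY_ w v
... | yes _ = ℕ.m≤n⇒m≤1+n (length-without v p)
... | no _  = ℕ.s≤s (length-without v p)

length-without-∷ : ∀ c v p → length (without v ((c , v) ∷ p)) ℕ.≤ length p
length-without-∷ c v p with L.≡-dec _≟XY_ v v
... | yes _  = length-without v p
... | no v≢v = ⊥-elim (v≢v refl)

lin-without : ∀ (g : Word → ℚ) v p → lin g p ≡ coeff p v * g v + lin g (without v p)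
lin-without g v [] = sym (trans (ℚ.+-identityʳ (0ℚ * g v)) (ℚ.*-zeroˡ (g v)))
lin-without g v ((c , w) ∷ p) with L.≡-dec _≟XY_ w v
... | yes refl = trans (cong (c * g v +_) (lin-without g v p))
                       (solve 4 (λ c a b e → c :* b :+ (a :* b :+ e) := (c :+ a) :* b :+ e) refl
                              c (coeff p v) (g v) (lin g (without v p)))
... | no _     = trans (cong (c * g w +_) (lin-without g v p))
                       (solve 4 (λ t a b e → t :+ (a :* b :+ e) := a :* b :+ (t :+ e)) refl
                              (c * g w) (coeff p v) (g v) (lin g (without v p)))

lin-IsZero : ∀ (g : Word → ℚ) p → IsZero p → lin g p ≡ 0ℚ
lin-IsZero g p = go (length p) p ℕ.≤-refl
  where
  go : ∀ n p → length p ℕ.≤ n → IsZero p → lin g p ≡ 0ℚ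
  go _ [] _ _ = refl
  go (ℕ.suc n) ((c , v) ∷ p) (ℕ.s≤s len) p≈0 = begin
    lin g ((c , v) ∷ p)                                         ≡⟨ lin-without g v ((c , v) ∷ p) ⟩
    coeff ((c , v) ∷ p) v * g v + lin g (without v ((c , v) ∷ p))
      ≡⟨ cong₂ _+_ (cong (_* g v) (p≈0 v)) (go n (without v ((c , v) ∷ p)) shorter (IsZero-without v ((c , v) ∷ p) p≈0)) ⟩
    0ℚ * g v + 0ℚ                                               ≡⟨ cong (_+ 0ℚ) (ℚ.*-zeroˡ (g v)) ⟩
    0ℚ                                                          ∎
    where
    open ≡-Reasoning
    shorter : length (without v ((c , v) ∷ p)) ℕ.≤ n
    shorter = ℕ.≤-trans (length-without-∷ c v p) len

prodList : List YZ → H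
prodList = L.foldr (λ a p → ⟦ a ⟧ · p) one

linProd : List YZ → (Word → ℚ) → ℚ
linProd [] g = g []
linProd (y ∷ v) g = linProd v (λ s → g (Y ∷ s))
linProd (z ∷ v) g = linProd v (λ s → g (X ∷ s)) + linProd v (λ s → g (Y ∷ s))

lin-prodList : ∀ v (g : Word → ℚ) → lin g (prodList v) ≡ linProd v g
lin-prodList [] g = trans (ℚ.+-identityʳ (1ℚ * g [])) (ℚ.*-identityˡ (g []))
lin-prodList (y ∷ v) g = begin
  lin g (⟦ y ⟧ · prodList v)                     ≡⟨ lin-· g ⟦ y ⟧ (prodList v) ⟩
  1ℚ * lin (λ s → g (Y ∷ s)) (prodList v) + 0ℚ  ≡⟨ trans (ℚ.+-identityʳ _) (ℚ.*-identityˡ _) ⟩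
  lin (λ s → g (Y ∷ s)) (prodList v)             ≡⟨ lin-prodList v (λ s → g (Y ∷ s)) ⟩
  linProd (y ∷ v) g                              ∎
  where open ≡-Reasoning
lin-prodList (z ∷ v) g = begin
  lin g (⟦ z ⟧ · prodList v)                                  ≡⟨ lin-· g ⟦ z ⟧ (prodList v) ⟩
  1ℚ * lin gX (prodList v) + (1ℚ * lin gY (prodList v) + 0ℚ)
    ≡⟨ solve 2 (λ a b → con 1ℚ :* a :+ (con 1ℚ :* b :+ con 0ℚ) := a :+ b) refl (lin gX (prodList v)) (lin gY (prodList v)) ⟩
  lin gX (prodList v) + lin gY (prodList v)                   ≡⟨ cong₂ _+_ (lin-prodList v gX) (lin-prodList v gY) ⟩
  linProd (z ∷ v) g                                           ∎
  where
  open ≡-Reasoning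
  gX gY : Word → ℚ
  gX s = g (X ∷ s)
  gY s = g (Y ∷ s)

linProd-cong : ∀ v {f g : Word → ℚ} → (∀ s → f s ≡ g s) → linProd v f ≡ linProd v g
linProd-cong [] f≗g = f≗g []
linProd-cong (y ∷ v) f≗g = linProd-cong v (f≗g ∘ (Y ∷_))
linProd-cong (z ∷ v) f≗g = cong₂ _+_ (linProd-cong v (f≗g ∘ (X ∷_))) (linProd-cong v (f≗g ∘ (Y ∷_)))

linProd-+ : ∀ v (f g : Word → ℚ) → linProd v (λ s → f s + g s) ≡ linProd v f + linProd v g
linProd-+ [] f g = refl
linProd-+ (y ∷ v) f g = linProd-+ v (f ∘ (Y ∷_)) (g ∘ (Y ∷_))
linProd-+ (z ∷ v) f g =
  trans (cong₂ _+_ (linProd-+ v (f ∘ (X ∷_)) (g ∘ (X ∷_))) (linProd-+ v (f ∘ (Y ∷_)) (g ∘ (Y ∷_))))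
        (+-interchange (linProd v (f ∘ (X ∷_))) (linProd v (g ∘ (X ∷_)))
                       (linProd v (f ∘ (Y ∷_))) (linProd v (g ∘ (Y ∷_))))

linProd-* : ∀ v c (f : Word → ℚ) → linProd v (λ s → c * f s) ≡ c * linProd v f
linProd-* [] c f = refl
linProd-* (y ∷ v) c f = linProd-* v c (f ∘ (Y ∷_))
linProd-* (z ∷ v) c f =
  trans (cong₂ _+_ (linProd-* v c (f ∘ (X ∷_))) (linProd-* v c (f ∘ (Y ∷_))))
        (sym (ℚ.*-distribˡ-+ c (linProd v (f ∘ (X ∷_))) (linProd v (f ∘ (Y ∷_)))))

linProd-neg : ∀ v (f : Word → ℚ) → linProd v (λ s → - f s) ≡ - linProd v f
linProd-neg [] f = refl
linProd-neg (y ∷ v) f = linProd-neg v (f ∘ (Y ∷_))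
linProd-neg (z ∷ v) f =
  trans (cong₂ _+_ (linProd-neg v (f ∘ (X ∷_))) (linProd-neg v (f ∘ (Y ∷_))))
        (sym (ℚ.neg-distrib-+ (linProd v (f ∘ (X ∷_))) (linProd v (f ∘ (Y ∷_)))))

linProd-0 : ∀ v → linProd v (λ _ → 0ℚ) ≡ 0ℚ
linProd-0 v = trans (linProd-* v 0ℚ (λ _ → 0ℚ)) (ℚ.*-zeroˡ (linProd v (λ _ → 0ℚ)))

linProd-++ : ∀ p r (K : Word → ℚ) → linProd (p ++ r) K ≡ linProd p (λ q → linProd r (λ q′ → K (q ++ q′)))
linProd-++ [] r K = refl
linProd-++ (y ∷ p) r K = linProd-++ p r (K ∘ (Y ∷_))
linProd-++ (z ∷ p) r K = cong₂ _+_ (linProd-++ p r (K ∘ (X ∷_))) (linProd-++ p r (K ∘ (Y ∷_)))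

linProd-comm : ∀ v p (K : Word → Word → ℚ)
  → linProd p (λ q → linProd v (λ s → K s q)) ≡ linProd v (λ s → linProd p (λ q → K s q))
linProd-comm [] p K = refl
linProd-comm (y ∷ v) p K = linProd-comm v p (K ∘ (Y ∷_))
linProd-comm (z ∷ v) p K =
  trans (linProd-+ p (λ q → linProd v (λ s → K (X ∷ s) q)) (λ q → linProd v (λ s → K (Y ∷ s) q)))
        (cong₂ _+_ (linProd-comm v p (K ∘ (X ∷_))) (linProd-comm v p (K ∘ (Y ∷_))))

sgn : XY → ℚ
sgn X = 1ℚ
sgn Y = - 1ℚ

-- cyclicTerms q (a₁⋯aₙ) = Σᵢ sgn(aᵢ) x aᵢ₊₁⋯aₙ q a₁⋯aᵢ₋₁ y
cyclicTerms : Word → Word → H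
cyclicTerms q [] = []
cyclicTerms q (b ∷ s) = (sgn b , X ∷ s ++ q ++ Y ∷ []) ∷ cyclicTerms (q ++ b ∷ []) s

multiplyAround : Word → H⊗H → H
multiplyAround q = map (λ { (c , (w₁ , w₂)) → (c , w₁ ++ q ++ w₂) })

multiplyAround-⋄ₗ : ∀ b q T → multiplyAround q ((b ∷ []) ⋄ₗ T) ≡ multiplyAround (q ++ b ∷ []) T
multiplyAround-⋄ₗ b q [] = refl
multiplyAround-⋄ₗ b q ((c , (w₁ , w₂)) ∷ T) =
  cong₂ _∷_ (cong (λ r → (c , w₁ ++ r)) (sym (L.++-assoc q (b ∷ []) w₂))) (multiplyAround-⋄ₗ b q T)

multiplyAround-C₀word : ∀ q s → multiplyAround q (C₀word s) ≡ cyclicTerms q s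
multiplyAround-C₀word q [] = refl
multiplyAround-C₀word q (b ∷ s) =
  trans (L.map-++ _ (C₀gen b ⋄ᵣ s) ((b ∷ []) ⋄ₗ C₀word s))
        (cong₂ _++_ (leading b) (trans (multiplyAround-⋄ₗ b q (C₀word s)) (multiplyAround-C₀word (q ++ b ∷ []) s)))
  where
  leading : ∀ b → multiplyAround q (C₀gen b ⋄ᵣ s) ≡ (sgn b , X ∷ s ++ q ++ Y ∷ []) ∷ []
  leading X = refl
  leading Y = refl

M₀-scaled : ∀ c T → M₀ (map (λ { (d , t) → (c * d , t) }) T) ≡ scale c (M₀ T)
M₀-scaled c [] = refl
M₀-scaled c ((d , (w₁ , w₂)) ∷ T) = cong ((c * d , w₁ ++ w₂) ∷_) (M₀-scaled c T)

ρ₀-explicit : ∀ p → ρ₀ p ≡ concatMap (λ { (c , w) → scale c (cyclicTerms [] w) }) p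
ρ₀-explicit [] = refl
ρ₀-explicit ((c , w) ∷ p) =
  trans (L.map-++ _ (map (λ { (d , t) → (c * d , t) }) (C₀word w)) (C₀ p))
        (cong₂ _++_ (trans (M₀-scaled c (C₀word w)) (cong (scale c) M₀-C₀word)) (ρ₀-explicit p))
  where
  M₀-C₀word : M₀ (C₀word w) ≡ cyclicTerms [] w
  M₀-C₀word = trans (L.map-cong (λ { (c , (w₁ , w₂)) → refl }) (C₀word w)) (multiplyAround-C₀word [] w)

linXPY : (Word → ℚ) → List YZ → ℚ
linXPY g w = linProd w (λ s → g (X ∷ s ++ Y ∷ []))

-- yRotSum f v p = Σ f (β ++ p ++ α), over the ways of writing v = α ++ y ∷ β
yRotSum : (List YZ → ℚ) → List YZ → List YZ → ℚ
yRotSum f [] p = 0ℚ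
yRotSum f (y ∷ v) p = f (v ++ p) + yRotSum f v (p ++ y ∷ [])
yRotSum f (z ∷ v) p = yRotSum f v (p ++ z ∷ [])

linAround : (Word → ℚ) → List YZ → Word → ℚ
linAround g v q = linProd v (λ s → g (X ∷ s ++ q ++ Y ∷ []))

linCyclic : (Word → ℚ) → List YZ → Word → ℚ
linCyclic g v q = linProd v (λ s → lin g (cyclicTerms q s))

linCyclic-∷ : ∀ (g : Word → ℚ) v q b
  → linProd v (λ s → lin g (cyclicTerms q (b ∷ s))) ≡ sgn b * linAround g v q + linCyclic g v (q ++ b ∷ [])
linCyclic-∷ g v q b =
  trans (linProd-+ v (λ s → sgn b * g (X ∷ s ++ q ++ Y ∷ [])) (λ s → lin g (cyclicTerms (q ++ b ∷ []) s)))
        (cong (_+ linCyclic g v (q ++ b ∷ [])) (linProd-* v (sgn b) (λ s → g (X ∷ s ++ q ++ Y ∷ []))))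

linProd-linAround : ∀ (g : Word → ℚ) v p → linProd p (linAround g v) ≡ linXPY g (v ++ p)
linProd-linAround g v p = begin
  linProd p (λ q → linProd v (λ s → g (X ∷ s ++ q ++ Y ∷ [])))
    ≡⟨ linProd-comm v p (λ s q → g (X ∷ s ++ q ++ Y ∷ [])) ⟩
  linProd v (λ s → linProd p (λ q → g (X ∷ s ++ q ++ Y ∷ [])))
    ≡⟨ linProd-cong v (λ s → linProd-cong p (λ q → cong (λ r → g (X ∷ r)) (sym (L.++-assoc s q (Y ∷ []))))) ⟩
  linProd v (λ s → linProd p (λ q → g (X ∷ (s ++ q) ++ Y ∷ [])))
    ≡⟨ linProd-++ v p (λ s → g (X ∷ s ++ Y ∷ [])) ⟨
  linXPY g (v ++ p) ∎
  where open ≡-Reasoning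

linProd-linCyclic : ∀ (g : Word → ℚ) v p → linProd p (linCyclic g v) ≡ - yRotSum (linXPY g) v p
linProd-linCyclic g [] p = linProd-0 p
linProd-linCyclic g (y ∷ v) p = begin
  linProd p (linCyclic g (y ∷ v))
    ≡⟨ linProd-cong p (λ q → linCyclic-∷ g v q Y) ⟩
  linProd p (λ q → - 1ℚ * linAround g v q + linCyclic g v (q ++ Y ∷ []))
    ≡⟨ linProd-+ p (λ q → - 1ℚ * linAround g v q) (λ q → linCyclic g v (q ++ Y ∷ [])) ⟩
  linProd p (λ q → - 1ℚ * linAround g v q) + linProd p (λ q → linCyclic g v (q ++ Y ∷ []))
    ≡⟨ cong (linProd p (λ q → - 1ℚ * linAround g v q) +_) (linProd-++ p (y ∷ []) (linCyclic g v)) ⟨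
  linProd p (λ q → - 1ℚ * linAround g v q) + linProd (p ++ y ∷ []) (linCyclic g v)
    ≡⟨ cong₂ _+_ (trans (linProd-* p (- 1ℚ) (linAround g v)) (cong (- 1ℚ *_) (linProd-linAround g v p)))
                 (linProd-linCyclic g v (p ++ y ∷ [])) ⟩
  - 1ℚ * linXPY g (v ++ p) + - yRotSum (linXPY g) v (p ++ y ∷ [])
    ≡⟨ solve 2 (λ a b → :- con 1ℚ :* a :+ :- b := :- (a :+ b)) refl
               (linXPY g (v ++ p)) (yRotSum (linXPY g) v (p ++ y ∷ [])) ⟩
  - yRotSum (linXPY g) (y ∷ v) p ∎
  where open ≡-Reasoning
linProd-linCyclic g (z ∷ v) p = begin
  linProd p (linCyclic g (z ∷ v))
    ≡⟨ linProd-cong p (λ q → trans (cong₂ _+_ (linCyclic-∷ g v q X) (linCyclic-∷ g v q Y))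
                                   (cancel (linAround g v q) (linCyclic g v (q ++ X ∷ [])) (linCyclic g v (q ++ Y ∷ [])))) ⟩
  linProd p (λ q → linCyclic g v (q ++ X ∷ []) + linCyclic g v (q ++ Y ∷ []))
    ≡⟨ linProd-++ p (z ∷ []) (linCyclic g v) ⟨
  linProd (p ++ z ∷ []) (linCyclic g v)
    ≡⟨ linProd-linCyclic g v (p ++ z ∷ []) ⟩
  - yRotSum (linXPY g) (z ∷ v) p ∎
  where
  open ≡-Reasoning
  cancel : ∀ r a b → (1ℚ * r + a) + (- 1ℚ * r + b) ≡ a + b
  cancel = solve 3 (λ r a b → (con 1ℚ :* r :+ a) :+ (:- con 1ℚ :* r :+ b) := a :+ b) refl

lin-ρ̃₀ : ∀ {l} (g : Word → ℚ) (u : Vec YZ l) → lin g (ρ̃₀ u) ≡ - yRotSum (linXPY g) (V.toList u) []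
lin-ρ̃₀ g u = begin
  lin g (ρ₀ (prodList v))                                    ≡⟨ cong (lin g) (ρ₀-explicit (prodList v)) ⟩
  lin g (concatMap (λ { (c , w) → scale c (cyclicTerms [] w) }) (prodList v))
                                                              ≡⟨ lin-concatMap-scale g (cyclicTerms []) (prodList v) ⟩
  lin (λ w → lin g (cyclicTerms [] w)) (prodList v)          ≡⟨ lin-prodList v (λ w → lin g (cyclicTerms [] w)) ⟩
  linCyclic g v []                                           ≡⟨ linProd-linCyclic g v [] ⟩
  - yRotSum (linXPY g) v []                                  ∎
  where
  open ≡-Reasoning
  v : List YZ
  v = V.toList u

δ : List YZ → List YZ → ℚ
δ [] [] = 1ℚ
δ (y ∷ w) (y ∷ m) = δ w m
δ (z ∷ w) (z ∷ m) = δ w m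
δ _ _ = 0ℚ

δ-refl : ∀ w → δ w w ≡ 1ℚ
δ-refl [] = refl
δ-refl (y ∷ w) = δ-refl w
δ-refl (z ∷ w) = δ-refl w

δ-≢ : ∀ w m → w ≢ m → δ w m ≡ 0ℚ
δ-≢ [] [] w≢m = ⊥-elim (w≢m refl)
δ-≢ (y ∷ w) (y ∷ m) w≢m = δ-≢ w m (w≢m ∘ cong (y ∷_))
δ-≢ (z ∷ w) (z ∷ m) w≢m = δ-≢ w m (w≢m ∘ cong (z ∷_))
δ-≢ [] (_ ∷ _) _ = refl
δ-≢ (y ∷ _) [] _ = refl
δ-≢ (z ∷ _) [] _ = refl
δ-≢ (y ∷ _) (z ∷ _) _ = refl
δ-≢ (z ∷ _) (y ∷ _) _ = refl

δ-nonNeg : ∀ w m → 0ℚ ≤ℚ δ w m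
δ-nonNeg [] [] = ℚ.nonNegative⁻¹ 1ℚ
δ-nonNeg (y ∷ w) (y ∷ m) = δ-nonNeg w m
δ-nonNeg (z ∷ w) (z ∷ m) = δ-nonNeg w m
δ-nonNeg [] (_ ∷ _) = ℚ.≤-refl
δ-nonNeg (y ∷ _) [] = ℚ.≤-refl
δ-nonNeg (z ∷ _) [] = ℚ.≤-refl
δ-nonNeg (y ∷ _) (z ∷ _) = ℚ.≤-refl
δ-nonNeg (z ∷ _) (y ∷ _) = ℚ.≤-refl

isY : Word → ℚ
isY [] = 0ℚ
isY (X ∷ _) = 0ℚ
isY (Y ∷ []) = 1ℚ
isY (Y ∷ _ ∷ _) = 0ℚ

isY-∷-++ : ∀ a s → isY (a ∷ s ++ Y ∷ []) ≡ 0ℚ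
isY-∷-++ X s = refl
isY-∷-++ Y [] = refl
isY-∷-++ Y (_ ∷ _) = refl

-- coordY w m is the coefficient of the product m·y when the word w is expanded in the basis of
-- products of y and z; the sign comes from x = z − y.
coordY : Word → List YZ → ℚ
coordY w [] = isY w
coordY (X ∷ w) (z ∷ m) = coordY w m
coordY (X ∷ w) (y ∷ m) = - coordY w m
coordY (Y ∷ w) (y ∷ m) = coordY w m
coordY _ _ = 0ℚ

xpyCoord : List YZ → Word → ℚ
xpyCoord m (X ∷ w) = coordY w m
xpyCoord m _ = 0ℚ

linXPY-xpyCoord : ∀ w m → linXPY (xpyCoord m) w ≡ δ w m
linXPY-xpyCoord [] [] = refl
linXPY-xpyCoord [] (y ∷ []) = refl
linXPY-xpyCoord [] (y ∷ _ ∷ _) = refl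
linXPY-xpyCoord [] (z ∷ _) = refl
linXPY-xpyCoord (y ∷ w) [] = trans (linProd-cong w (isY-∷-++ Y)) (linProd-0 w)
linXPY-xpyCoord (z ∷ w) [] = cong₂ _+_ (trans (linProd-cong w (isY-∷-++ X)) (linProd-0 w))
                                       (trans (linProd-cong w (isY-∷-++ Y)) (linProd-0 w))
linXPY-xpyCoord (y ∷ w) (y ∷ m) = linXPY-xpyCoord w m
linXPY-xpyCoord (y ∷ w) (z ∷ m) = linProd-0 w
linXPY-xpyCoord (z ∷ w) (y ∷ m) =
  trans (cong (_+ linXPY (xpyCoord m) w) (linProd-neg w (λ s → coordY (s ++ Y ∷ []) m)))
        (ℚ.+-inverseˡ (linXPY (xpyCoord m) w))
linXPY-xpyCoord (z ∷ w) (z ∷ m) =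
  trans (cong₂ _+_ (linXPY-xpyCoord w m) (linProd-0 w)) (ℚ.+-identityʳ (δ w m))

shift-cut : ∀ (β p : List YZ) a α → β ++ (p ++ a ∷ []) ++ α ≡ β ++ p ++ a ∷ α
shift-cut β p a α = cong (β ++_) (L.++-assoc p (a ∷ []) α)

VanishesOnCuts : (List YZ → ℚ) → List YZ → List YZ → Set
VanishesOnCuts f v p = ∀ α β → v ≡ α ++ y ∷ β → f (β ++ p ++ α) ≡ 0ℚ

VanishesOnCuts-∷ : ∀ f {a v} p → VanishesOnCuts f (a ∷ v) p → VanishesOnCuts f v (p ++ a ∷ [])
VanishesOnCuts-∷ f {a} p vanish α β v≡ =
  trans (cong f (shift-cut β p a α)) (vanish (a ∷ α) β (cong (a ∷_) v≡))

yRotSum-zero : ∀ f v p → VanishesOnCuts f v p → yRotSum f v p ≡ 0ℚ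
yRotSum-zero f [] p vanish = refl
yRotSum-zero f (y ∷ v) p vanish =
  cong₂ _+_ (trans (cong (λ r → f (v ++ r)) (sym (L.++-identityʳ p))) (vanish [] v refl))
            (yRotSum-zero f v (p ++ y ∷ []) (VanishesOnCuts-∷ f p vanish))
yRotSum-zero f (z ∷ v) p vanish = yRotSum-zero f v (p ++ z ∷ []) (VanishesOnCuts-∷ f p vanish)

module _ (f : List YZ → ℚ) (f≥0 : ∀ w → 0ℚ ≤ℚ f w) where

  yRotSum-nonNeg : ∀ v p → 0ℚ ≤ℚ yRotSum f v p
  yRotSum-nonNeg [] p = ℚ.≤-refl
  yRotSum-nonNeg (y ∷ v) p = ℚ.+-mono-≤ (f≥0 (v ++ p)) (yRotSum-nonNeg v (p ++ y ∷ []))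
  yRotSum-nonNeg (z ∷ v) p = yRotSum-nonNeg v (p ++ z ∷ [])

  yRotSum-pos : ∀ α β p → 0ℚ < f (β ++ p ++ α) → 0ℚ < yRotSum f (α ++ y ∷ β) p
  yRotSum-pos [] β p f>0 =
    ℚ.+-mono-<-≤ (subst (λ r → 0ℚ < f (β ++ r)) (L.++-identityʳ p) f>0) (yRotSum-nonNeg β (p ++ y ∷ []))
  yRotSum-pos (y ∷ α) β p f>0 =
    ℚ.+-mono-≤-< (f≥0 ((α ++ y ∷ β) ++ p)) (yRotSum-pos α β (p ++ y ∷ []) (subst (λ r → 0ℚ < f r) (sym (shift-cut β p y α)) f>0))
  yRotSum-pos (z ∷ α) β p f>0 =
    yRotSum-pos α β (p ++ z ∷ []) (subst (λ r → 0ℚ < f r) (sym (shift-cut β p z α)) f>0)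

rotList₁ : List YZ → List YZ
rotList₁ [] = []
rotList₁ (a ∷ as) = as ++ a ∷ []

rotList : ℕ → List YZ → List YZ
rotList ℕ.zero as = as
rotList (ℕ.suc j) as = rotList₁ (rotList j as)

toList-rot : ∀ {n} j (u : Vec YZ n) → V.toList (rot j u) ≡ rotList j (V.toList u)
toList-rot ℕ.zero u = refl
toList-rot (ℕ.suc j) u = trans (toList-rot₁ (rot j u)) (cong rotList₁ (toList-rot j u))
  where
  toList-rot₁ : ∀ {n} (u : Vec YZ n) → V.toList (rot₁ u) ≡ rotList₁ (V.toList u)
  toList-rot₁ V.[] = refl
  toList-rot₁ (a V.∷ as) = V.toList-∷ʳ a as

rotList-suc : ∀ j as → rotList (ℕ.suc j) as ≡ rotList j (rotList₁ as)
rotList-suc ℕ.zero as = refl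
rotList-suc (ℕ.suc j) as = cong rotList₁ (rotList-suc j as)

rotList-++ : ∀ α β → rotList (length α) (α ++ β) ≡ β ++ α
rotList-++ [] β = sym (L.++-identityʳ β)
rotList-++ (a ∷ α) β = begin
  rotList (ℕ.suc (length α)) (a ∷ α ++ β)  ≡⟨ rotList-suc (length α) (a ∷ α ++ β) ⟩
  rotList (length α) ((α ++ β) ++ a ∷ [])  ≡⟨ cong (rotList (length α)) (L.++-assoc α β (a ∷ [])) ⟩
  rotList (length α) (α ++ β ++ a ∷ [])    ≡⟨ rotList-++ α (β ++ a ∷ []) ⟩
  (β ++ a ∷ []) ++ α                       ≡⟨ L.++-assoc β (a ∷ []) α ⟩
  β ++ a ∷ α                               ∎
  where open ≡-Reasoning

rot-+ : ∀ {n} i j (u : Vec YZ n) → rot (i ℕ.+ j) u ≡ rot i (rot j u)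
rot-+ ℕ.zero j u = refl
rot-+ (ℕ.suc i) j u = cong rot₁ (rot-+ i j u)

toList-rot-cut : ∀ {n} (u : Vec YZ n) α β → V.toList u ≡ α ++ β → V.toList (rot (length α) u) ≡ β ++ α
toList-rot-cut u α β u≡ = trans (toList-rot (length α) u) (trans (cong (rotList (length α)) u≡) (rotList-++ α β))

toList-injective : ∀ {n} {u v : Vec YZ n} → V.toList u ≡ V.toList v → u ≡ v
toList-injective {u = u} {v} u≡v = trans (sym (V.cast-is-id refl u)) (V.toList-injective refl u v u≡v)

-- length α turns bring u to y ∷ β ++ α = y ∷ β′ ++ α′, and length (y ∷ β′) more turns give v.
CycEq-fromCuts : ∀ {n} {u v : Vec YZ n} α β α′ β′ → V.toList u ≡ α ++ y ∷ β → V.toList v ≡ α′ ++ y ∷ β′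
  → β ++ α ≡ β′ ++ α′ → CycEq u v
CycEq-fromCuts {u = u} {v} α β α′ β′ u≡ v≡ eq = length (y ∷ β′) ℕ.+ length α , (begin
  rot (length (y ∷ β′) ℕ.+ length α) u      ≡⟨ rot-+ (length (y ∷ β′)) (length α) u ⟩
  rot (length (y ∷ β′)) (rot (length α) u)  ≡⟨ cong (rot (length (y ∷ β′))) sameCut ⟩
  rot (length (y ∷ β′)) (rot (length α′) v) ≡⟨ toList-injective back ⟩
  v                                         ∎)
  where
  open ≡-Reasoning
  sameCut : rot (length α) u ≡ rot (length α′) v
  sameCut = toList-injective (trans (toList-rot-cut u α (y ∷ β) u≡)
                             (trans (cong (y ∷_) eq) (sym (toList-rot-cut v α′ (y ∷ β′) v≡))))
  back : V.toList (rot (length (y ∷ β′)) (rot (length α′) v)) ≡ V.toList v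
  back = trans (toList-rot-cut _ (y ∷ β′) α′ (toList-rot-cut v α′ (y ∷ β′) v≡)) (sym v≡)

cut-or-allZ : ∀ {n} (u : Vec YZ n) → (∃[ α ] ∃[ β ] V.toList u ≡ α ++ y ∷ β) ⊎ u ≡ replicate n z
cut-or-allZ V.[] = inj₂ refl
cut-or-allZ (y V.∷ u) = inj₁ ([] , V.toList u , refl)
cut-or-allZ (z V.∷ u) with cut-or-allZ u
... | inj₁ (α , β , u≡) = inj₁ (z ∷ α , β , cong (z ∷_) u≡)
... | inj₂ u≡zⁿ = inj₂ (cong (z V.∷_) u≡zⁿ)

module _ {A : Set} (R : A → A → Set) (f : A → ℚ) {a₀ : A}
         (vanishˡ : ∀ a → ¬ R a a₀ → f a ≡ 0ℚ) (vanishʳ : ∀ a → ¬ R a₀ a → f a ≡ 0ℚ) where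

  lin-vanish : ∀ fam → All (λ b → ¬ R a₀ (proj₂ b)) fam → lin f fam ≡ 0ℚ
  lin-vanish [] [] = refl
  lin-vanish ((c , a) ∷ fam) (¬a₀Ra ∷ unrelated) =
    trans (cong₂ _+_ (trans (cong (c *_) (vanishʳ a ¬a₀Ra)) (ℚ.*-zeroʳ c)) (lin-vanish fam unrelated))
          (ℚ.+-identityʳ 0ℚ)

  lin-isolate : ∀ {c₀} fam → AllPairs (λ p q → ¬ R (proj₂ p) (proj₂ q)) fam → (c₀ , a₀) ∈ fam → lin f fam ≡ c₀ * f a₀
  lin-isolate {c₀} (_ ∷ fam) (unrelated ∷ _) (here refl) =
    trans (cong (c₀ * f a₀ +_) (lin-vanish fam unrelated)) (ℚ.+-identityʳ (c₀ * f a₀))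
  lin-isolate {c₀} ((c , a) ∷ fam) (unrelated ∷ distinct) (there mem) =
    trans (cong₂ _+_ (trans (cong (c *_) (vanishˡ a (All.lookup unrelated mem))) (ℚ.*-zeroʳ c))
                     (lin-isolate fam distinct mem))
          (ℚ.+-identityˡ (c₀ * f a₀))

p*q≡0⇒p≡0 : ∀ p q .{{_ : ℚ.NonZero q}} → p * q ≡ 0ℚ → p ≡ 0ℚ
p*q≡0⇒p≡0 p q pq≡0 = begin
  p                ≡⟨ ℚ.*-identityʳ p ⟨
  p * 1ℚ           ≡⟨ cong (p *_) (ℚ.*-inverseʳ q) ⟨
  p * (q * ℚ.1/ q) ≡⟨ ℚ.*-assoc p q (ℚ.1/ q) ⟨
  p * q * ℚ.1/ q   ≡⟨ cong (_* ℚ.1/ q) pq≡0 ⟩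
  0ℚ * ℚ.1/ q      ≡⟨ ℚ.*-zeroˡ (ℚ.1/ q) ⟩
  0ℚ               ∎
  where open ≡-Reasoning

coefficient-vanishes : ∀ {l} (fam : List (ℚ × Vec YZ l))
  → AllPairs (λ a b → ¬ CycEq (proj₂ a) (proj₂ b)) fam
  → All (λ a → ¬ CycEq (proj₂ a) (replicate l z)) fam
  → IsZero (linComb fam)
  → ∀ {c₀ u₀} → (c₀ , u₀) ∈ fam → c₀ ≡ 0ℚ
coefficient-vanishes {l} fam distinct notAllZ fam≈0 {c₀} {u₀} mem with cut-or-allZ u₀
... | inj₂ u₀≡zˡ = ⊥-elim (All.lookup notAllZ mem (0 , u₀≡zˡ))
... | inj₁ (α₀ , β₀ , u₀≡) = p*q≡0⇒p≡0 c₀ (F u₀) {{ℚ.<-nonZero F[u₀]<0}} (begin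
  c₀ * F u₀            ≡⟨ lin-isolate CycEq F vanishˡ vanishʳ fam distinct mem ⟨
  lin F fam            ≡⟨ lin-concatMap-scale G ρ̃₀ fam ⟨
  lin G (linComb fam)  ≡⟨ lin-IsZero G (linComb fam) fam≈0 ⟩
  0ℚ                   ∎)
  where
  open ≡-Reasoning
  m : List YZ
  m = β₀ ++ α₀
  G : Word → ℚ
  G = xpyCoord m
  F : Vec YZ l → ℚ
  F u = lin G (ρ̃₀ u)
  G≥0 : ∀ w → 0ℚ ≤ℚ linXPY G w
  G≥0 w = subst (0ℚ ≤ℚ_) (sym (linXPY-xpyCoord w m)) (δ-nonNeg w m)
  G[m]>0 : 0ℚ < linXPY G m
  G[m]>0 = subst (0ℚ <_) (sym (trans (linXPY-xpyCoord m m) (δ-refl m))) (ℚ.positive⁻¹ 1ℚ)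
  F[u₀]<0 : F u₀ < 0ℚ
  F[u₀]<0 = subst (_< 0ℚ) (sym (lin-ρ̃₀ G u₀)) (ℚ.neg-antimono-<
    (subst (λ v → 0ℚ < yRotSum (linXPY G) v []) (sym u₀≡) (yRotSum-pos (linXPY G) G≥0 α₀ β₀ [] G[m]>0)))
  F-vanish : ∀ u → (∀ α β → V.toList u ≡ α ++ y ∷ β → β ++ α ≢ m) → F u ≡ 0ℚ
  F-vanish u noCut = trans (lin-ρ̃₀ G u) (cong -_ (yRotSum-zero (linXPY G) (V.toList u) [] λ α β u≡ →
    trans (linXPY-xpyCoord (β ++ α) m) (δ-≢ (β ++ α) m (noCut α β u≡))))
  vanishˡ : ∀ u → ¬ CycEq u u₀ → F u ≡ 0ℚ
  vanishˡ u ¬u~u₀ = F-vanish u λ α β u≡ eq → ¬u~u₀ (CycEq-fromCuts α β α₀ β₀ u≡ u₀≡ eq)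
  vanishʳ : ∀ u → ¬ CycEq u₀ u → F u ≡ 0ℚ
  vanishʳ u ¬u₀~u = F-vanish u λ α β u≡ eq → ¬u₀~u (CycEq-fromCuts α₀ β₀ α β u₀≡ u≡ (sym eq))

proposition5p4 : (l : ℕ) → 1 ≤ l → (fam : List (ℚ × Vec YZ l))
    → AllPairs (λ a b → ¬ CycEq (proj₂ a) (proj₂ b)) fam
    → All (λ a → ¬ CycEq (proj₂ a) (replicate l z)) fam
    → IsZero (linComb fam)
    → All (λ a → proj₁ a ≡ 0ℚ) fam
proposition5p4 l _ fam distinct notAllZ fam≈0 = All.tabulate (coefficient-vanishes fam distinct notAllZ fam≈0)
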